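{- Let $\beta\ge1$ and let $(T,\mathcal L)$ be a $\beta$-extra list edge coloring instance on a tree rooted at $r$ with children $v_1,\dots,v_d$, $e_i=\{r,v_i\}$. For each $i\in[d]$ let $\mathbf p_i\in\mathbb R_{\ge0}^{C_{v_i}}$ be a nonzero vector, and let $\mathbf p_r=f(\mathbf p_1,\dots,\mathbf p_d)$. Then for every color $a\in[q]$, \[\mathbf p_r(a)\le\frac{d}{\beta-1+d}\qquad\text{and}\qquad(\beta-1)\,\mathbf p_r(a)\le d\,\mathbf p_r(\bar a).\]
   Context: Lists $\mathcal L(e)\subseteq[q]$; $\deg(e)$ is the number of edges other than $e$ sharing an endpoint with $e$; $\beta$-extra means $|\mathcal L(e)|\ge\deg(e)+\beta$ for all edges. For a vertex $u$, $E_{T_u}(u)$ is the set of edges from $u$ to its children and $C_u$ the set of proper partial colorings of $E_{T_u}(u)$ (colors from the lists, pairwise distinct). For $\mathbf p\in\mathbb R_{\ge0}^{C_u}$ and a color $c$: $\mathbf p(\bar c)=\sum_{\tau\in C_u:\,c\notin\tau}\mathbf p(\tau)$ and $\mathbf p(c)=\sum_{\tau\in C_u:\,c\in\tau}\mathbf p(\tau)$, where $c\in\tau$ means $\tau$ uses color $c$. The map $f=(f_\pi)_{\pi\in C_r}$ is $f_\pi(\mathbf p_1,\dots,\mathbf p_d)=\frac{\prod_i\mathbf p_i(\overline{\pi(e_i)})}{\sum_{\rho\in C_r}\prod_i\mathbf p_i(\overline{\rho(e_i)})}$. -}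

module Defs where

open import Data.Nat using (ℕ; zero; suc; _∸_) renaming (_+_ to _+ℕ_; _≤_ to _≤ℕ_)
open import Data.Fin using (Fin; _≟_)
open import Data.Fin.Subset using (Subset; ∣_∣)
open import Data.Fin.Subset.Properties using (_∈?_)
open import Data.Vec using (Vec; []; _∷_; lookup)
open import Data.Maybe using (Maybe; nothing; just)
open import Data.Bool using (Bool; true; false; _∧_; _∨_; not)
open import Data.List using (List; []; _∷_; map; concatMap; allFin; filterᵇ; foldr)
open import Data.Product using (_×_; ∃)
open import Data.Unit using (⊤)
import Data.Sum
open import Relation.Nullary.Decidable using (⌊_⌋)
open import Relation.Binary.PropositionalEquality using (_≡_; _≢_)

-- The real numbers, axiomatised as a complete ordered field
-- (unique up to isomorphism).  Convention: 0 ⁻¹ = 0 (total inverse).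

record CompleteOrderedField : Set₁ where
  infixl 6 _+_
  infixl 7 _*_
  infix 4 _≤_
  field
    Carrier : Set
    0# 1# : Carrier
    _+_ _*_ : Carrier → Carrier → Carrier
    -_ : Carrier → Carrier
    _⁻¹ : Carrier → Carrier
    _≤_ : Carrier → Carrier → Set
    +-assoc : ∀ x y z → (x + y) + z ≡ x + (y + z)
    +-comm : ∀ x y → x + y ≡ y + x
    +-identityˡ : ∀ x → 0# + x ≡ x
    +-inverseˡ : ∀ x → (- x) + x ≡ 0#
    *-assoc : ∀ x y z → (x * y) * z ≡ x * (y * z)
    *-comm : ∀ x y → x * y ≡ y * x
    *-identityˡ : ∀ x → 1# * x ≡ x
    distribˡ : ∀ x y z → x * (y + z) ≡ x * y + x * z
    0≢1 : 0# ≢ 1#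
    ⁻¹-inverse : ∀ x → x ≢ 0# → x * (x ⁻¹) ≡ 1#
    ⁻¹-zero : 0# ⁻¹ ≡ 0#
    ≤-refl : ∀ x → x ≤ x
    ≤-antisym : ∀ {x y} → x ≤ y → y ≤ x → x ≡ y
    ≤-trans : ∀ {x y z} → x ≤ y → y ≤ z → x ≤ z
    ≤-total : ∀ x y → (x ≤ y) Data.Sum.⊎ (y ≤ x)
    +-mono-≤ : ∀ {x y} z → x ≤ y → x + z ≤ y + z
    *-nonneg : ∀ {x y} → 0# ≤ x → 0# ≤ y → 0# ≤ x * y
    complete : (S : Carrier → Set) → ∃ S → ∃ (λ b → ∀ x → S x → x ≤ b) →
               ∃ (λ s → (∀ x → S x → x ≤ s) × (∀ b → (∀ x → S x → x ≤ b) → s ≤ b))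

-- Rooted trees with a list L(e) ⊆ [q] on every edge.
-- node Ls ts : the i-th child edge carries list (lookup Ls i), leads to
-- subtree (lookup ts i).

data RTree (q : ℕ) : Set where
  node : {k : ℕ} → Vec (Subset q) k → Vec (RTree q) k → RTree q

arity : ∀ {q} → RTree q → ℕ
arity (node {k} _ _) = k

edgeLists : ∀ {q} (u : RTree q) → Vec (Subset q) (arity u)
edgeLists (node Ls _) = Ls

-- β-extra condition on every edge of the tree.
-- hasParent = 1 if the node has a parent edge, 0 for the root.
-- For an edge from u (k children, hasParent p) to child w:
--   deg(e) = (k - 1) + p + (number of children of w).
mutual
  Extra : ∀ {q} → (β hasParent : ℕ) → RTree q → Set
  Extra β p (node {k} Ls ts) = ExtraV β p k Ls ts

  ExtraV : ∀ {q m} → (β hasParent k : ℕ) → Vec (Subset q) m → Vec (RTree q) m → Set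
  ExtraV β p k [] [] = ⊤
  ExtraV β p k (L ∷ Ls) (t ∷ ts) =
    ((k ∸ 1) +ℕ p +ℕ arity t +ℕ β ≤ℕ ∣ L ∣) × Extra β 1 t × ExtraV β p k Ls ts

BetaExtra : ∀ {q} → ℕ → RTree q → Set
BetaExtra β T = Extra β 0 T

-- Partial colourings of the child edges of a node: nothing = uncoloured.

allVecs : (q k : ℕ) → List (Vec (Maybe (Fin q)) k)
allVecs q zero = [] ∷ []
allVecs q (suc k) =
  concatMap (λ m → map (m ∷_) (allVecs q k)) (nothing ∷ map just (allFin q))

uses : ∀ {q k} → Maybe (Fin q) → Vec (Maybe (Fin q)) k → Bool
uses nothing τ = false
uses (just c) [] = false
uses (just c) (nothing ∷ τ) = uses (just c) τ
uses (just c) (just c′ ∷ τ) = ⌊ c ≟ c′ ⌋ ∨ uses (just c) τ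

proper : ∀ {q k} → Vec (Subset q) k → Vec (Maybe (Fin q)) k → Bool
proper [] [] = true
proper (L ∷ Ls) (nothing ∷ τ) = proper Ls τ
proper (L ∷ Ls) (just c ∷ τ) = ⌊ c ∈? L ⌋ ∧ not (uses (just c) τ) ∧ proper Ls τ

Colorings : ∀ {q k} → Vec (Subset q) k → List (Vec (Maybe (Fin q)) k)
Colorings {q} {k} Ls = filterᵇ (proper Ls) (allVecs q k)

C : ∀ {q} (u : RTree q) → List (Vec (Maybe (Fin q)) (arity u))
C u = Colorings (edgeLists u)

module Real (R : CompleteOrderedField) where
  open CompleteOrderedField R

  sumR : List Carrier → Carrier
  sumR = foldr _+_ 0#

  fromℕ : ℕ → Carrier
  fromℕ zero = 0#
  fromℕ (suc n) = 1# + fromℕ n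

  -- p(\bar m): mass of colourings not using m (m = nothing: total mass)
  massBar : ∀ {q k} → List (Vec (Maybe (Fin q)) k) → (Vec (Maybe (Fin q)) k → Carrier) →
            Maybe (Fin q) → Carrier
  massBar Cs p m = sumR (map p (filterᵇ (λ τ → not (uses m τ)) Cs))

  mass : ∀ {q k} → List (Vec (Maybe (Fin q)) k) → (Vec (Maybe (Fin q)) k → Carrier) →
         Fin q → Carrier
  mass Cs p c = sumR (map p (filterᵇ (uses (just c)) Cs))

  module Root {q d : ℕ} (Ls : Vec (Subset q) d) (ts : Vec (RTree q) d)
              (p : (i : Fin d) → Vec (Maybe (Fin q)) (arity (lookup ts i)) → Carrier) where

    weight : Vec (Maybe (Fin q)) d → Carrier
    weight π = foldr (λ i acc → massBar (C (lookup ts i)) (p i) (lookup π i) * acc) 1# (allFin d)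

    Z : Carrier
    Z = sumR (map weight (Colorings Ls))

    f : Vec (Maybe (Fin q)) d → Carrier
    f π = weight π * (Z ⁻¹)

    pr : Fin q → Carrier
    pr a = mass (Colorings Ls) f a

    prBar : Fin q → Carrier
    prBar a = massBar (Colorings Ls) f (just a)

{-# OPTIONS --safe #-}
-- Let Z be the total weight ∏ᵢ pᵢ(\overline{π(eᵢ)}) of the proper colourings π of the root edges,
-- so p_r(a) = U/Z and p_r(ā) = N/Z with U and N the parts of Z using and avoiding a.  Avoiding a
-- means deleting a from every list, so N is the same total for the lists L ∖ a, and the heart of
-- the proof is (β-1)·Z(L) ≤ (β-1+d)·Z(L ∖ a), by induction on the root edges.  When the first
-- edge is coloured a, its weight p₁(ā) ≤ p₁(total) is outweighed by giving it instead a colour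
-- left free both by the other root edges and by the colouring of v₁'s child edges: β-extra
-- leaves at least β-1 of these for every child colouring, so ∑_c p₁(c̄) ≥ (β-1)·p₁(total).
-- Hence (β-1)·U ≤ d·N, and U + N = Z gives both inequalities.
module Submission where

open import Defs
open import Algebra.Bundles using (CommutativeMonoid; CommutativeRing)
open import Algebra.Consequences.Propositional using (comm∧idˡ⇒id; comm∧invˡ⇒inv)
open import Algebra.Consequences.Setoid using (comm∧distrˡ⇒distr)
open import Data.Bool using (Bool; true; false; _∧_; not)
open import Data.Bool.Properties using (∧-comm; ∧-identityʳ; ∧-zeroʳ; ∧-commutativeMonoid)
open import Data.Empty using (⊥-elim)
open import Data.Fin using (Fin; zero; suc; _≟_)
open import Data.Fin.Subset using (Subset; ∣_∣; _-_; _─_; ⁅_⁆) renaming (⊥ to ∅)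
open import Data.Fin.Subset.Properties using (_∈?_; p─⊥≡p; p─q⊆p; x∈p∧x≢y⇒x∈p-y; p─x─y≡p─y─x)
open import Data.List using (List; []; _∷_; map; filterᵇ; concatMap; _++_; allFin; foldr; tabulate)
open import Data.List.Membership.Propositional using () renaming (_∈_ to _∈ₗ_)
open import Data.List.Properties using (map-tabulate; foldr-map)
open import Data.List.Relation.Unary.Any using (here; there)
open import Data.Maybe using (Maybe; nothing; just)
open import Data.Nat using (ℕ; zero; suc; z≤n; s≤s; s≤s⁻¹; _∸_)
  renaming (_+_ to _+ℕ_; _≤_ to _≤ℕ_; _<_ to _<ℕ_)
import Data.Nat.Properties as ℕ
open import Data.Product using (_×_; ∃; _,_; proj₁; proj₂)
open import Data.Sum using (inj₁; inj₂)
open import Data.Vec using (Vec; []; _∷_; lookup)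
import Data.Vec as Vec
open import Data.Vec.Properties using (lookup-map)
open import Function using (id; _∘_)
open import Function.Bundles using (mk⇔)
open import Relation.Binary.Bundles using (Poset)
open import Relation.Binary.PropositionalEquality
import Relation.Binary.Reasoning.PartialOrder
open import Relation.Nullary.Decidable using (⌊_⌋; ⌊⌋-map′; does; does-⇔; isYes≗does; yes; no)

open import Algebra.Properties.CommutativeSemigroup (CommutativeMonoid.commutativeSemigroup ∧-commutativeMonoid)
  using () renaming (x∙yz≈y∙xz to x∧[y∧z]≡y∧[x∧z])

free : ∀ {q k} → Subset q → Vec (Maybe (Fin q)) k → Subset q
free L []            = L
free L (nothing ∷ τ) = free L τ
free L (just c ∷ τ)  = free L τ - c

infixl 5 _∖_
_∖_ : ∀ {q n} → Vec (Subset q) n → Fin q → Vec (Subset q) n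
Ls ∖ c = Vec.map (_- c) Ls

⌊x∈?p-x⌋ : ∀ {n} (x : Fin n) (p : Subset n) → ⌊ x ∈? (p - x) ⌋ ≡ false
⌊x∈?p-x⌋ zero    (s ∷ p) = refl
⌊x∈?p-x⌋ (suc x) (s ∷ p) = trans (⌊⌋-map′ _ _ (x ∈? (p - x))) (⌊x∈?p-x⌋ x p)

⌊x∈?p-y⌋ : ∀ {n} {x y : Fin n} (p : Subset n) → x ≢ y → ⌊ x ∈? (p - y) ⌋ ≡ ⌊ x ∈? p ⌋
⌊x∈?p-y⌋ {x = x} {y} p x≢y = begin
  ⌊ x ∈? (p - y) ⌋     ≡⟨ isYes≗does (x ∈? (p - y)) ⟩
  does (x ∈? (p - y))  ≡⟨ does-⇔ (mk⇔ (p─q⊆p p ⁅ y ⁆) (λ x∈p → x∈p∧x≢y⇒x∈p-y x∈p x≢y)) (x ∈? (p - y)) (x ∈? p) ⟩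
  does (x ∈? p)        ≡⟨ isYes≗does (x ∈? p) ⟨
  ⌊ x ∈? p ⌋           ∎
  where open ≡-Reasoning

∣p∣≤1+∣p-x∣ : ∀ {n} (p : Subset n) x → ∣ p ∣ ≤ℕ suc ∣ p - x ∣
∣p∣≤1+∣p-x∣ (true  ∷ p) zero    = ℕ.≤-reflexive (cong (suc ∘ ∣_∣) (sym (p─⊥≡p p)))
∣p∣≤1+∣p-x∣ (false ∷ p) zero    = ℕ.≤-trans (ℕ.≤-reflexive (cong ∣_∣ (sym (p─⊥≡p p)))) (ℕ.n≤1+n _)
∣p∣≤1+∣p-x∣ (true  ∷ p) (suc x) = s≤s (∣p∣≤1+∣p-x∣ p x)
∣p∣≤1+∣p-x∣ (false ∷ p) (suc x) = ∣p∣≤1+∣p-x∣ p x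

m<∣p∣⇒m≤∣p-x∣ : ∀ {n m} (p : Subset n) x → m <ℕ ∣ p ∣ → m ≤ℕ ∣ p - x ∣
m<∣p∣⇒m≤∣p-x∣ p x m<∣p∣ = s≤s⁻¹ (ℕ.≤-trans m<∣p∣ (∣p∣≤1+∣p-x∣ p x))

⌊∈?free⌋ : ∀ {q k} (c : Fin q) (L : Subset q) (τ : Vec (Maybe (Fin q)) k) →
           ⌊ c ∈? free L τ ⌋ ≡ ⌊ c ∈? L ⌋ ∧ not (uses (just c) τ)
⌊∈?free⌋ c L []            = sym (∧-identityʳ _)
⌊∈?free⌋ c L (nothing ∷ τ) = ⌊∈?free⌋ c L τ
⌊∈?free⌋ c L (just x ∷ τ) with c ≟ x
... | yes refl = trans (⌊x∈?p-x⌋ c (free L τ)) (sym (∧-zeroʳ _))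
... | no  c≢x  = trans (⌊x∈?p-y⌋ (free L τ) c≢x) (⌊∈?free⌋ c L τ)

k+m≤∣L∣⇒m≤∣free∣ : ∀ {q k} m (L : Subset q) (τ : Vec (Maybe (Fin q)) k) → k +ℕ m ≤ℕ ∣ L ∣ → m ≤ℕ ∣ free L τ ∣
k+m≤∣L∣⇒m≤∣free∣ m L []                 k+m≤∣L∣ = k+m≤∣L∣
k+m≤∣L∣⇒m≤∣free∣ m L (nothing ∷ τ)      k+m≤∣L∣ = k+m≤∣L∣⇒m≤∣free∣ m L τ (ℕ.<⇒≤ k+m≤∣L∣)
k+m≤∣L∣⇒m≤∣free∣ {k = suc k} m L (just c ∷ τ) k+m≤∣L∣ =
  m<∣p∣⇒m≤∣p-x∣ (free L τ) c (k+m≤∣L∣⇒m≤∣free∣ (suc m) L τ (subst (_≤ℕ ∣ L ∣) (sym (ℕ.+-suc k m)) k+m≤∣L∣))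

proper-∖ : ∀ {q n} (c : Fin q) (Ls : Vec (Subset q) n) (τ : Vec (Maybe (Fin q)) n) →
           proper (Ls ∖ c) τ ≡ not (uses (just c) τ) ∧ proper Ls τ
proper-∖ c []       []            = refl
proper-∖ c (L ∷ Ls) (nothing ∷ τ) = proper-∖ c Ls τ
proper-∖ c (L ∷ Ls) (just x ∷ τ) with c ≟ x
... | yes refl rewrite ⌊x∈?p-x⌋ c L = refl
... | no  c≢x  rewrite ⌊x∈?p-y⌋ L (c≢x ∘ sym) | proper-∖ c Ls τ =
  trans (cong (⌊ x ∈? L ⌋ ∧_) (x∧[y∧z]≡y∧[x∧z] (not (uses (just x) τ)) (not (uses (just c) τ)) (proper Ls τ)))
        (x∧[y∧z]≡y∧[x∧z] ⌊ x ∈? L ⌋ (not (uses (just c) τ)) (not (uses (just x) τ) ∧ proper Ls τ))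

∖-comm : ∀ {q n} (Ls : Vec (Subset q) n) c a → Ls ∖ c ∖ a ≡ Ls ∖ a ∖ c
∖-comm []       c a = refl
∖-comm (L ∷ Ls) c a = cong₂ _∷_ (p─x─y≡p─y─x L c a) (∖-comm Ls c a)

ExtraV-lookup : ∀ {q m} β h k (Ls : Vec (Subset q) m) (ts : Vec (RTree q) m) → ExtraV β h k Ls ts →
                ∀ i → (k ∸ 1) +ℕ h +ℕ arity (lookup ts i) +ℕ β ≤ℕ ∣ lookup Ls i ∣
ExtraV-lookup β h k (L ∷ Ls) (t ∷ ts) (bound , _ , _)    zero    = bound
ExtraV-lookup β h k (L ∷ Ls) (t ∷ ts) (_     , _ , rest) (suc i) = ExtraV-lookup β h k Ls ts rest i

root-edge-bound : ∀ {q k} β (Ls : Vec (Subset q) (suc k)) (ts : Vec (RTree q) (suc k)) →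
                  BetaExtra (suc β) (node Ls ts) →
                  ∀ i → suc k +ℕ (arity (lookup ts i) +ℕ β) ≤ℕ ∣ lookup Ls i ∣
root-edge-bound {k = k} β Ls ts extra i = subst (_≤ℕ ∣ lookup Ls i ∣) (begin
  k +ℕ 0 +ℕ K +ℕ suc β    ≡⟨ cong (λ x → x +ℕ K +ℕ suc β) (ℕ.+-identityʳ k) ⟩
  k +ℕ K +ℕ suc β         ≡⟨ ℕ.+-suc (k +ℕ K) β ⟩
  suc (k +ℕ K +ℕ β)       ≡⟨ cong suc (ℕ.+-assoc k K β) ⟩
  suc k +ℕ (K +ℕ β)       ∎) (ExtraV-lookup (suc β) 0 (suc k) Ls ts extra i)
  where
  open ≡-Reasoning
  K : ℕ
  K = arity (lookup ts i)

module OrderedFieldProperties (R : CompleteOrderedField) where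
  open CompleteOrderedField R renaming (+-mono-≤ to +-monoˡ-≤)
  open Real R using (fromℕ)

  commutativeRing : CommutativeRing _ _
  commutativeRing = record
    { isCommutativeRing = record
      { isRing = record
        { +-isAbelianGroup = record
          { isGroup = record
            { isMonoid = record
              { isSemigroup = record
                { isMagma = record { isEquivalence = isEquivalence ; ∙-cong = cong₂ _+_ }
                ; assoc = +-assoc }
              ; identity = comm∧idˡ⇒id +-comm +-identityˡ }
            ; inverse = comm∧invˡ⇒inv +-comm +-inverseˡ
            ; ⁻¹-cong = cong (λ x → - x) }
          ; comm = +-comm }
        ; *-cong = cong₂ _*_
        ; *-assoc = *-assoc
        ; *-identity = comm∧idˡ⇒id *-comm *-identityˡ
        ; distrib = comm∧distrˡ⇒distr (setoid Carrier) (cong₂ _+_) *-comm distribˡ }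
      ; *-comm = *-comm } }

  open CommutativeRing commutativeRing public
    using (+-identityʳ; -‿inverseʳ; *-identityʳ; zeroˡ; zeroʳ; distribʳ)

  open import Algebra.Properties.CommutativeSemigroup (CommutativeRing.+-commutativeSemigroup commutativeRing)
    public using () renaming (interchange to +-interchange; x∙yz≈y∙xz to x+[y+z]≡y+[x+z])
  open import Algebra.Properties.CommutativeSemigroup (CommutativeRing.*-commutativeSemigroup commutativeRing)
    public using () renaming (x∙yz≈y∙xz to x*[y*z]≡y*[x*z])
  open import Algebra.Properties.Ring (CommutativeRing.ring commutativeRing)
    using (x[y-z]≈xy-xz; -‿distribˡ-*; -‿distribʳ-*; -‿involutive)

  ≤-poset : Poset _ _ _
  ≤-poset = record
    { isPartialOrder = record
      { isPreorder = record
        { isEquivalence = isEquivalence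
        ; reflexive = λ { {x} refl → ≤-refl x }
        ; trans = ≤-trans }
      ; antisym = ≤-antisym } }

  open Poset ≤-poset public using () renaming (reflexive to ≤-reflexive)
  module ≤-Reasoning = Relation.Binary.Reasoning.PartialOrder ≤-poset

  +-monoʳ-≤ : ∀ x {y z} → y ≤ z → x + y ≤ x + z
  +-monoʳ-≤ x {y} {z} y≤z = subst₂ _≤_ (+-comm y x) (+-comm z x) (+-monoˡ-≤ x y≤z)

  +-mono-≤ : ∀ {x y u v} → x ≤ y → u ≤ v → x + u ≤ y + v
  +-mono-≤ {y = y} {u} x≤y u≤v = ≤-trans (+-monoˡ-≤ u x≤y) (+-monoʳ-≤ y u≤v)

  +-cancelʳ-≤ : ∀ z {x y} → x + z ≤ y + z → x ≤ y
  +-cancelʳ-≤ z {x} {y} le = subst₂ _≤_ (cancel x) (cancel y) (+-monoˡ-≤ (- z) le)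
    where
    cancel : ∀ w → w + z + - z ≡ w
    cancel w = trans (+-assoc w z (- z)) (trans (cong (w +_) (-‿inverseʳ z)) (+-identityʳ w))

  x≤x+y : ∀ {x y} → 0# ≤ y → x ≤ x + y
  x≤x+y {x} {y} 0≤y = subst (_≤ x + y) (+-identityʳ x) (+-monoʳ-≤ x 0≤y)

  x≤y+x : ∀ {x y} → 0# ≤ y → x ≤ y + x
  x≤y+x {x} {y} 0≤y = subst (x ≤_) (+-comm x y) (x≤x+y 0≤y)

  +-nonneg : ∀ {x y} → 0# ≤ x → 0# ≤ y → 0# ≤ x + y
  +-nonneg {y = y} 0≤x 0≤y = ≤-trans 0≤y (x≤y+x 0≤x)

  *-monoˡ-≤-nonneg : ∀ {c x y} → 0# ≤ c → x ≤ y → c * x ≤ c * y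
  *-monoˡ-≤-nonneg {c} {x} {y} 0≤c x≤y =
    +-cancelʳ-≤ (- (c * x)) (subst₂ _≤_ (sym (-‿inverseʳ (c * x))) c[y-x] 0≤c[y-x])
    where
    0≤c[y-x] : 0# ≤ c * (y + - x)
    0≤c[y-x] = *-nonneg 0≤c (subst₂ _≤_ (-‿inverseʳ x) refl (+-monoˡ-≤ (- x) x≤y))
    c[y-x] : c * (y + - x) ≡ c * y + - (c * x)
    c[y-x] = x[y-z]≈xy-xz c y x

  *-monoʳ-≤-nonneg : ∀ {c x y} → 0# ≤ c → x ≤ y → x * c ≤ y * c
  *-monoʳ-≤-nonneg {c} {x} {y} 0≤c x≤y = subst₂ _≤_ (*-comm c x) (*-comm c y) (*-monoˡ-≤-nonneg 0≤c x≤y)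

  x*x-nonneg : ∀ x → 0# ≤ x * x
  x*x-nonneg x with ≤-total 0# x
  ... | inj₁ 0≤x = *-nonneg 0≤x 0≤x
  ... | inj₂ x≤0 = subst (0# ≤_) -x*-x≡x*x (*-nonneg 0≤-x 0≤-x)
    where
    0≤-x : 0# ≤ - x
    0≤-x = subst₂ _≤_ (-‿inverseʳ x) (+-identityˡ (- x)) (+-monoˡ-≤ (- x) x≤0)
    -x*-x≡x*x : - x * - x ≡ x * x
    -x*-x≡x*x = trans (sym (-‿distribˡ-* x (- x)))
                      (trans (cong -_ (sym (-‿distribʳ-* x x))) (-‿involutive (x * x)))

  0≤1 : 0# ≤ 1#
  0≤1 = subst (0# ≤_) (*-identityˡ 1#) (x*x-nonneg 1#)

  x≢0∧x≤y⇒y≢0 : ∀ {x y} → 0# ≤ x → x ≤ y → x ≢ 0# → y ≢ 0#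
  x≢0∧x≤y⇒y≢0 0≤x x≤y x≢0 refl = x≢0 (≤-antisym x≤y 0≤x)

  *-≢0 : ∀ {x y} → x ≢ 0# → y ≢ 0# → x * y ≢ 0#
  *-≢0 {x} {y} x≢0 y≢0 xy≡0 = y≢0 (begin
    y                ≡⟨ sym (*-identityˡ y) ⟩
    1# * y           ≡⟨ cong (_* y) (sym (trans (*-comm (x ⁻¹) x) (⁻¹-inverse x x≢0))) ⟩
    x ⁻¹ * x * y     ≡⟨ *-assoc (x ⁻¹) x y ⟩
    x ⁻¹ * (x * y)   ≡⟨ cong (x ⁻¹ *_) xy≡0 ⟩
    x ⁻¹ * 0#        ≡⟨ zeroʳ (x ⁻¹) ⟩
    0#               ∎)
    where open ≡-Reasoning

  ⁻¹-nonneg : ∀ {x} → 0# ≤ x → x ≢ 0# → 0# ≤ x ⁻¹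
  ⁻¹-nonneg {x} 0≤x x≢0 with ≤-total 0# (x ⁻¹)
  ... | inj₁ 0≤x⁻¹ = 0≤x⁻¹
  ... | inj₂ x⁻¹≤0 = ⊥-elim (0≢1 (≤-antisym 0≤1 1≤0))
    where
    1≤0 : 1# ≤ 0#
    1≤0 = subst₂ _≤_ (⁻¹-inverse x x≢0) (zeroʳ x) (*-monoˡ-≤-nonneg 0≤x x⁻¹≤0)

  c*x≤y⇒x≤y*c⁻¹ : ∀ {c x y} → 0# ≤ c → c ≢ 0# → c * x ≤ y → x ≤ y * c ⁻¹
  c*x≤y⇒x≤y*c⁻¹ {c} {x} {y} 0≤c c≢0 cx≤y = begin
    x                ≡⟨ sym (*-identityʳ x) ⟩
    x * 1#           ≡⟨ cong (x *_) (sym (⁻¹-inverse c c≢0)) ⟩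
    x * (c * c ⁻¹)   ≡⟨ sym (*-assoc x c (c ⁻¹)) ⟩
    x * c * c ⁻¹     ≡⟨ cong (_* c ⁻¹) (*-comm x c) ⟩
    c * x * c ⁻¹     ≤⟨ *-monoʳ-≤-nonneg (⁻¹-nonneg 0≤c c≢0) cx≤y ⟩
    y * c ⁻¹         ∎
    where open ≤-Reasoning

  fromℕ-+ : ∀ m n → fromℕ (m +ℕ n) ≡ fromℕ m + fromℕ n
  fromℕ-+ zero    n = sym (+-identityˡ (fromℕ n))
  fromℕ-+ (suc m) n = trans (cong (1# +_) (fromℕ-+ m n)) (sym (+-assoc 1# (fromℕ m) (fromℕ n)))

  fromℕ-nonneg : ∀ n → 0# ≤ fromℕ n
  fromℕ-nonneg zero    = ≤-refl 0#
  fromℕ-nonneg (suc n) = +-nonneg 0≤1 (fromℕ-nonneg n)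

  fromℕ-mono-≤ : ∀ {m n} → m ≤ℕ n → fromℕ m ≤ fromℕ n
  fromℕ-mono-≤ {n = n} z≤n = fromℕ-nonneg n
  fromℕ-mono-≤ (s≤s m≤n) = +-monoʳ-≤ 1# (fromℕ-mono-≤ m≤n)

  fromℕ-suc≢0 : ∀ n → fromℕ (suc n) ≢ 0#
  fromℕ-suc≢0 n = x≢0∧x≤y⇒y≢0 0≤1 (x≤x+y (fromℕ-nonneg n)) (λ 1≡0 → 0≢1 (sym 1≡0))

  b*y≤m*z⇒b*[x*y]≤m*[x*z] : ∀ {b m x y z} → 0# ≤ x → b * y ≤ m * z → b * (x * y) ≤ m * (x * z)
  b*y≤m*z⇒b*[x*y]≤m*[x*z] {b} {m} {x} {y} {z} 0≤x by≤mz = begin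
    b * (x * y)   ≡⟨ x*[y*z]≡y*[x*z] b x y ⟩
    x * (b * y)   ≤⟨ *-monoˡ-≤-nonneg 0≤x by≤mz ⟩
    x * (m * z)   ≡⟨ x*[y*z]≡y*[x*z] x m z ⟩
    m * (x * z)   ∎
    where open ≤-Reasoning

  m*x+[y+m*y]≤[1+m]*[x+y] : ∀ {m x y} → 0# ≤ x → m * x + (y + m * y) ≤ (1# + m) * (x + y)
  m*x+[y+m*y]≤[1+m]*[x+y] {m} {x} {y} 0≤x = begin
    m * x + (y + m * y)      ≡⟨ x+[y+z]≡y+[x+z] (m * x) y (m * y) ⟩
    y + (m * x + m * y)      ≡⟨ cong (y +_) (sym (distribˡ m x y)) ⟩
    y + m * (x + y)          ≤⟨ +-monoˡ-≤ (m * (x + y)) (x≤y+x 0≤x) ⟩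
    (x + y) + m * (x + y)    ≡⟨ cong (_+ m * (x + y)) (sym (*-identityˡ (x + y))) ⟩
    1# * (x + y) + m * (x + y) ≡⟨ distribʳ (x + y) 1# m ⟨
    (1# + m) * (x + y)       ∎
    where open ≤-Reasoning

  b*[u+n]≤[b+d]*n⇒b*u≤d*n : ∀ {b d u n} → b * (u + n) ≤ (b + d) * n → b * u ≤ d * n
  b*[u+n]≤[b+d]*n⇒b*u≤d*n {b} {d} {u} {n} le = +-cancelʳ-≤ (b * n) (begin
    b * u + b * n    ≡⟨ sym (distribˡ b u n) ⟩
    b * (u + n)      ≤⟨ le ⟩
    (b + d) * n      ≡⟨ distribʳ n b d ⟩
    b * n + d * n    ≡⟨ +-comm (b * n) (d * n) ⟩
    d * n + b * n    ∎)
    where open ≤-Reasoning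

  b*x≤d*y⇒x≤d/[b+d] : ∀ {b d x y} → 0# ≤ b → 0# ≤ d → b + d ≢ 0# → x + y ≡ 1# →
                      b * x ≤ d * y → x ≤ d * (b + d) ⁻¹
  b*x≤d*y⇒x≤d/[b+d] {b} {d} {x} {y} 0≤b 0≤d b+d≢0 x+y≡1 bx≤dy =
    c*x≤y⇒x≤y*c⁻¹ (+-nonneg 0≤b 0≤d) b+d≢0 (begin
      (b + d) * x      ≡⟨ distribʳ x b d ⟩
      b * x + d * x    ≤⟨ +-monoˡ-≤ (d * x) bx≤dy ⟩
      d * y + d * x    ≡⟨ sym (distribˡ d y x) ⟩
      d * (y + x)      ≡⟨ cong (d *_) (trans (+-comm y x) x+y≡1) ⟩
      d * 1#           ≡⟨ *-identityʳ d ⟩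
      d                ∎)
    where open ≤-Reasoning

module Sums (R : CompleteOrderedField) where
  open CompleteOrderedField R hiding (-_) renaming (+-mono-≤ to +-monoˡ-≤)
  open Real R using (sumR; fromℕ)
  open OrderedFieldProperties R

  ∑ : {A : Set} → List A → (A → Carrier) → Carrier
  ∑ xs F = sumR (map F xs)

  infixr 6.5 ∑
  syntax ∑ xs (λ x → F) = ∑[ x ← xs ] F

  infixr 6.5 [_]·_
  [_]·_ : Bool → Carrier → Carrier
  [ true  ]· x = x
  [ false ]· x = 0#

  private variable A B : Set

  ∑-cong : ∀ (xs : List A) {F G : A → Carrier} → (∀ x → F x ≡ G x) → ∑ xs F ≡ ∑ xs G
  ∑-cong []       F≗G = refl
  ∑-cong (x ∷ xs) F≗G = cong₂ _+_ (F≗G x) (∑-cong xs F≗G)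

  ∑-mono-≤ : ∀ (xs : List A) {F G : A → Carrier} → (∀ x → x ∈ₗ xs → F x ≤ G x) → ∑ xs F ≤ ∑ xs G
  ∑-mono-≤ []       F≤G = ≤-refl 0#
  ∑-mono-≤ (x ∷ xs) F≤G = +-mono-≤ (F≤G x (here refl)) (∑-mono-≤ xs (λ y y∈xs → F≤G y (there y∈xs)))

  ∑-nonneg : ∀ (xs : List A) {F : A → Carrier} → (∀ x → x ∈ₗ xs → 0# ≤ F x) → 0# ≤ ∑ xs F
  ∑-nonneg []       0≤F = ≤-refl 0#
  ∑-nonneg (x ∷ xs) 0≤F = +-nonneg (0≤F x (here refl)) (∑-nonneg xs (λ y y∈xs → 0≤F y (there y∈xs)))

  term≤∑ : ∀ (xs : List A) {F : A → Carrier} → (∀ x → x ∈ₗ xs → 0# ≤ F x) → ∀ {y} → y ∈ₗ xs → F y ≤ ∑ xs F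
  term≤∑ (x ∷ xs) 0≤F (here refl) = x≤x+y (∑-nonneg xs (λ y y∈xs → 0≤F y (there y∈xs)))
  term≤∑ (x ∷ xs) 0≤F (there y∈xs) =
    ≤-trans (term≤∑ xs (λ z z∈xs → 0≤F z (there z∈xs)) y∈xs) (x≤y+x (0≤F x (here refl)))

  ∑-zero : ∀ (xs : List A) → ∑[ x ← xs ] 0# ≡ 0#
  ∑-zero []       = refl
  ∑-zero (x ∷ xs) = trans (+-identityˡ _) (∑-zero xs)

  ∑-distrib-+ : ∀ (xs : List A) (F G : A → Carrier) → ∑[ x ← xs ] (F x + G x) ≡ ∑ xs F + ∑ xs G
  ∑-distrib-+ []       F G = sym (+-identityˡ 0#)
  ∑-distrib-+ (x ∷ xs) F G = trans (cong (F x + G x +_) (∑-distrib-+ xs F G)) (+-interchange (F x) (G x) _ _)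

  *-distribˡ-∑ : ∀ c (xs : List A) (F : A → Carrier) → c * ∑ xs F ≡ ∑[ x ← xs ] c * F x
  *-distribˡ-∑ c []       F = zeroʳ c
  *-distribˡ-∑ c (x ∷ xs) F = trans (distribˡ c (F x) (∑ xs F)) (cong (c * F x +_) (*-distribˡ-∑ c xs F))

  *-distribʳ-∑ : ∀ c (xs : List A) (F : A → Carrier) → ∑ xs F * c ≡ ∑[ x ← xs ] F x * c
  *-distribʳ-∑ c xs F =
    trans (*-comm (∑ xs F) c) (trans (*-distribˡ-∑ c xs F) (∑-cong xs (λ x → *-comm c (F x))))

  ∑-++ : ∀ (xs ys : List A) (F : A → Carrier) → ∑ (xs ++ ys) F ≡ ∑ xs F + ∑ ys F
  ∑-++ []       ys F = sym (+-identityˡ (∑ ys F))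
  ∑-++ (x ∷ xs) ys F = trans (cong (F x +_) (∑-++ xs ys F)) (sym (+-assoc (F x) (∑ xs F) (∑ ys F)))

  ∑-map : ∀ (f : B → A) (xs : List B) (F : A → Carrier) → ∑ (map f xs) F ≡ ∑[ x ← xs ] F (f x)
  ∑-map f []       F = refl
  ∑-map f (x ∷ xs) F = cong (F (f x) +_) (∑-map f xs F)

  ∑-concatMap : ∀ (f : B → List A) (xs : List B) (F : A → Carrier) →
                ∑ (concatMap f xs) F ≡ ∑[ x ← xs ] ∑ (f x) F
  ∑-concatMap f []       F = refl
  ∑-concatMap f (x ∷ xs) F = trans (∑-++ (f x) (concatMap f xs) F) (cong (∑ (f x) F +_) (∑-concatMap f xs F))

  ∑-comm : ∀ (xs : List A) (ys : List B) (F : A → B → Carrier) →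
           ∑[ x ← xs ] ∑[ y ← ys ] F x y ≡ ∑[ y ← ys ] ∑[ x ← xs ] F x y
  ∑-comm []       ys F = sym (∑-zero ys)
  ∑-comm (x ∷ xs) ys F = trans (cong (∑ ys (F x) +_) (∑-comm xs ys F)) (sym (∑-distrib-+ ys (F x) _))

  ∑-filter : ∀ (P : A → Bool) (xs : List A) (F : A → Carrier) → ∑ (filterᵇ P xs) F ≡ ∑[ x ← xs ] [ P x ]· F x
  ∑-filter P []       F = refl
  ∑-filter P (x ∷ xs) F with P x
  ... | true  = cong (F x +_) (∑-filter P xs F)
  ... | false = trans (∑-filter P xs F) (sym (+-identityˡ _))

  ∑-filter-split : ∀ (P : A → Bool) (xs : List A) (F : A → Carrier) →
                   ∑ (filterᵇ P xs) F + ∑ (filterᵇ (λ x → not (P x)) xs) F ≡ ∑ xs F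
  ∑-filter-split P []       F = +-identityˡ 0#
  ∑-filter-split P (x ∷ xs) F with P x
  ... | true  = trans (+-assoc (F x) _ _) (cong (F x +_) (∑-filter-split P xs F))
  ... | false = trans (x+[y+z]≡y+[x+z] _ (F x) _) (cong (F x +_) (∑-filter-split P xs F))

  []·-nonneg : ∀ b {x} → 0# ≤ x → 0# ≤ [ b ]· x
  []·-nonneg true  0≤x = 0≤x
  []·-nonneg false 0≤x = ≤-refl 0#

  []·-≤ : ∀ b {x} → 0# ≤ x → [ b ]· x ≤ x
  []·-≤ true  0≤x = ≤-refl _
  []·-≤ false 0≤x = 0≤x

  []·-mono-≤ : ∀ b {x y} → x ≤ y → [ b ]· x ≤ [ b ]· y
  []·-mono-≤ true  x≤y = x≤y
  []·-mono-≤ false x≤y = ≤-refl 0#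

  []·-∧ : ∀ b c x → [ b ∧ c ]· x ≡ [ b ]· [ c ]· x
  []·-∧ true  c x = refl
  []·-∧ false c x = refl

  *-[]· : ∀ x b y → x * ([ b ]· y) ≡ [ b ]· (x * y)
  *-[]· x true  y = refl
  *-[]· x false y = zeroʳ x

  []·-* : ∀ b x y → ([ b ]· x) * y ≡ [ b ]· (x * y)
  []·-* true  x y = refl
  []·-* false x y = zeroˡ y

  []·-∑ : ∀ b (xs : List A) (F : A → Carrier) → [ b ]· ∑ xs F ≡ ∑[ x ← xs ] [ b ]· F x
  []·-∑ true  xs F = refl
  []·-∑ false xs F = sym (∑-zero xs)

  ∑ₛ : ∀ {q} → Subset q → (Fin q → Carrier) → Carrier
  ∑ₛ {q} L F = ∑[ c ← allFin q ] [ ⌊ c ∈? L ⌋ ]· F c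

  infixr 6.5 ∑ₛ
  syntax ∑ₛ L (λ c → F) = ∑[ c ∈ L ] F

  ∑-allFin-suc : ∀ {n} (F : Fin (suc n) → Carrier) → ∑ (allFin (suc n)) F ≡ F zero + ∑[ c ← allFin n ] F (suc c)
  ∑-allFin-suc {n} F =
    cong (F zero +_) (trans (cong (λ cs → ∑ cs F) (sym (map-tabulate id suc))) (∑-map suc (allFin n) F))

  ⌊zero∈?⌋ : ∀ {n} s (L : Subset n) → ⌊ zero ∈? (s ∷ L) ⌋ ≡ s
  ⌊zero∈?⌋ true  L = refl
  ⌊zero∈?⌋ false L = refl

  ∑ₛ-∷ : ∀ {n} s (L : Subset n) (F : Fin (suc n) → Carrier) →
         ∑[ c ∈ s ∷ L ] F c ≡ [ s ]· F zero + ∑[ c ∈ L ] F (suc c)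
  ∑ₛ-∷ s L F = trans (∑-allFin-suc (λ c → [ ⌊ c ∈? (s ∷ L) ⌋ ]· F c))
    (cong₂ _+_ (cong ([_]· F zero) (⌊zero∈?⌋ s L))
    (∑-cong (allFin _) (λ c → cong ([_]· F (suc c)) (⌊⌋-map′ _ _ (c ∈? L)))))

  ∑ₛ-const : ∀ {q} (L : Subset q) x → ∑[ c ∈ L ] x ≡ fromℕ ∣ L ∣ * x
  ∑ₛ-const []            x = sym (zeroˡ x)
  ∑ₛ-const (true  ∷ L) x = trans (∑ₛ-∷ true L (λ _ → x)) (trans (cong (x +_) (∑ₛ-const L x))
    (trans (cong (_+ fromℕ ∣ L ∣ * x) (sym (*-identityˡ x))) (sym (distribʳ x 1# (fromℕ ∣ L ∣)))))
  ∑ₛ-const (false ∷ L) x = trans (∑ₛ-∷ false L (λ _ → x)) (trans (+-identityˡ _) (∑ₛ-const L x))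

  ∑ₛ-remove : ∀ {q} (a : Fin q) (L : Subset q) (F : Fin q → Carrier) →
              ∑[ c ∈ L ] F c ≡ [ ⌊ a ∈? L ⌋ ]· F a + ∑[ c ∈ L - a ] F c
  ∑ₛ-remove zero (s ∷ L) F = begin
    ∑[ c ∈ s ∷ L ] F c
      ≡⟨ ∑ₛ-∷ s L F ⟩
    [ s ]· F zero + ∑[ c ∈ L ] F (suc c)
      ≡⟨ cong₂ (λ b M → [ b ]· F zero + M) (sym (⌊zero∈?⌋ s L)) rest ⟩
    [ ⌊ zero ∈? (s ∷ L) ⌋ ]· F zero + ∑[ c ∈ (s ∷ L) - zero ] F c
      ∎
    where
    open ≡-Reasoning
    rest : ∑[ c ∈ L ] F (suc c) ≡ ∑[ c ∈ (s ∷ L) - zero ] F c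
    rest = sym (trans (∑ₛ-∷ false (L ─ ∅) F)
                      (trans (+-identityˡ _) (cong (λ M → ∑[ c ∈ M ] F (suc c)) (p─⊥≡p L))))
  ∑ₛ-remove (suc a) (s ∷ L) F = begin
    ∑[ c ∈ s ∷ L ] F c
      ≡⟨ ∑ₛ-∷ s L F ⟩
    [ s ]· F zero + ∑[ c ∈ L ] F (suc c)
      ≡⟨ cong ([ s ]· F zero +_) (∑ₛ-remove a L (F ∘ suc)) ⟩
    [ s ]· F zero + ([ ⌊ a ∈? L ⌋ ]· F (suc a) + ∑[ c ∈ L - a ] F (suc c))
      ≡⟨ x+[y+z]≡y+[x+z] _ _ _ ⟩
    [ ⌊ a ∈? L ⌋ ]· F (suc a) + ([ s ]· F zero + ∑[ c ∈ L - a ] F (suc c))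
      ≡⟨ cong₂ (λ b M → [ b ]· F (suc a) + M) (sym (⌊⌋-map′ _ _ (a ∈? L))) (sym (∑ₛ-∷ s (L - a) F)) ⟩
    [ ⌊ suc a ∈? (s ∷ L) ⌋ ]· F (suc a) + ∑[ c ∈ (s ∷ L) - suc a ] F c
      ∎
    where open ≡-Reasoning

  ∑ₛ-cong : ∀ {q} (L : Subset q) {F G : Fin q → Carrier} → (∀ c → F c ≡ G c) → ∑[ c ∈ L ] F c ≡ ∑[ c ∈ L ] G c
  ∑ₛ-cong L F≗G = ∑-cong (allFin _) (λ c → cong ([ ⌊ c ∈? L ⌋ ]·_) (F≗G c))

  ∑ₛ-mono-≤ : ∀ {q} (L : Subset q) {F G : Fin q → Carrier} → (∀ c → F c ≤ G c) → ∑[ c ∈ L ] F c ≤ ∑[ c ∈ L ] G c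
  ∑ₛ-mono-≤ L F≤G = ∑-mono-≤ (allFin _) (λ c _ → []·-mono-≤ ⌊ c ∈? L ⌋ (F≤G c))

  ∑ₛ-nonneg : ∀ {q} (L : Subset q) {F : Fin q → Carrier} → (∀ c → 0# ≤ F c) → 0# ≤ ∑[ c ∈ L ] F c
  ∑ₛ-nonneg L 0≤F = ∑-nonneg (allFin _) (λ c _ → []·-nonneg ⌊ c ∈? L ⌋ (0≤F c))

  *-distribˡ-∑ₛ : ∀ {q} x (L : Subset q) (F : Fin q → Carrier) → x * (∑[ c ∈ L ] F c) ≡ ∑[ c ∈ L ] x * F c
  *-distribˡ-∑ₛ {q} x L F = trans (*-distribˡ-∑ x (allFin q) (λ c → [ ⌊ c ∈? L ⌋ ]· F c))
                                  (∑-cong (allFin q) (λ c → *-[]· x ⌊ c ∈? L ⌋ (F c)))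

  *-distribʳ-∑ₛ : ∀ {q} x (L : Subset q) (F : Fin q → Carrier) → (∑[ c ∈ L ] F c) * x ≡ ∑[ c ∈ L ] F c * x
  *-distribʳ-∑ₛ {q} x L F = trans (*-distribʳ-∑ x (allFin q) (λ c → [ ⌊ c ∈? L ⌋ ]· F c))
                                  (∑-cong (allFin q) (λ c → []·-* ⌊ c ∈? L ⌋ (F c) x))

module PartitionFunction (R : CompleteOrderedField) {q : ℕ} where
  open CompleteOrderedField R hiding (-_) renaming (+-mono-≤ to +-monoˡ-≤)
  open Real R using (fromℕ; mass; massBar)
  open OrderedFieldProperties R
  open Sums R

  Weights : ℕ → Set
  Weights n = Fin n → Maybe (Fin q) → Carrier

  W : ∀ {n} → Weights n → Vec (Maybe (Fin q)) n → Carrier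
  W {n} g π = foldr (λ i acc → g i (lookup π i) * acc) 1# (allFin n)

  Z : ∀ {n} → Vec (Subset q) n → Weights n → Carrier
  Z Ls g = ∑ (Colorings Ls) (W g)

  W-∷ : ∀ {n} (g : Weights (suc n)) m π → W g (m ∷ π) ≡ g zero m * W (g ∘ suc) π
  W-∷ {n} g m π = cong (g zero m *_) (begin
    foldr step 1# (tabulate (suc {n}))      ≡⟨ cong (foldr step 1#) (sym (map-tabulate id suc)) ⟩
    foldr step 1# (map suc (allFin n))      ≡⟨ foldr-map step suc 1# (allFin n) ⟩
    W (g ∘ suc) π                          ∎)
    where
    open ≡-Reasoning
    step : Fin (suc n) → Carrier → Carrier
    step i acc = g i (lookup (m ∷ π) i) * acc

  W-nonneg : ∀ {n} (g : Weights n) → (∀ i m → 0# ≤ g i m) → ∀ π → 0# ≤ W g π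
  W-nonneg g 0≤g []      = 0≤1
  W-nonneg g 0≤g (m ∷ π) =
    subst (0# ≤_) (sym (W-∷ g m π)) (*-nonneg (0≤g zero m) (W-nonneg (g ∘ suc) (0≤g ∘ suc) π))

  Z-nonneg : ∀ {n} (Ls : Vec (Subset q) n) (g : Weights n) → (∀ i m → 0# ≤ g i m) → 0# ≤ Z Ls g
  Z-nonneg Ls g 0≤g = ∑-nonneg (Colorings Ls) (λ π _ → W-nonneg g 0≤g π)

  Z-∑ : ∀ {n} (Ls : Vec (Subset q) n) (g : Weights n) x →
        x * Z Ls g ≡ ∑[ π ← allVecs q n ] [ proper Ls π ]· (x * W g π)
  Z-∑ {n} Ls g x = trans (cong (x *_) (∑-filter (proper Ls) (allVecs q n) (W g)))
    (trans (*-distribˡ-∑ x (allVecs q n) _) (∑-cong (allVecs q n) (λ π → *-[]· x (proper Ls π) (W g π))))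

  Z-∖ : ∀ {n} (c : Fin q) (Ls : Vec (Subset q) n) (g : Weights n) →
        Z (Ls ∖ c) g ≡ ∑[ π ← Colorings Ls ] [ not (uses (just c) π) ]· W g π
  Z-∖ {n} c Ls g = begin
    Z (Ls ∖ c) g
      ≡⟨ ∑-filter (proper (Ls ∖ c)) (allVecs q n) (W g) ⟩
    ∑[ π ← allVecs q n ] [ proper (Ls ∖ c) π ]· W g π
      ≡⟨ ∑-cong (allVecs q n) reorder ⟩
    ∑[ π ← allVecs q n ] [ proper Ls π ]· [ not (uses (just c) π) ]· W g π
      ≡⟨ ∑-filter (proper Ls) (allVecs q n) (λ π → [ not (uses (just c) π) ]· W g π) ⟨
    ∑[ π ← Colorings Ls ] [ not (uses (just c) π) ]· W g π
      ∎
    where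
    open ≡-Reasoning
    reorder : ∀ π → [ proper (Ls ∖ c) π ]· W g π ≡ [ proper Ls π ]· [ not (uses (just c) π) ]· W g π
    reorder π = trans (cong ([_]· W g π)
                            (trans (proper-∖ c Ls π) (∧-comm (not (uses (just c) π)) (proper Ls π))))
                      ([]·-∧ (proper Ls π) (not (uses (just c) π)) (W g π))

  ∑-allVecs-suc : ∀ {n} (H : Vec (Maybe (Fin q)) (suc n) → Carrier) →
                  ∑ (allVecs q (suc n)) H
                  ≡ ∑[ τ ← allVecs q n ] H (nothing ∷ τ) + ∑[ c ← allFin q ] ∑[ τ ← allVecs q n ] H (just c ∷ τ)
  ∑-allVecs-suc {n} H = trans (∑-concatMap (λ m → map (m ∷_) (allVecs q n)) (nothing ∷ map just (allFin q)) H)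
    (cong₂ _+_ (∑-map (nothing ∷_) (allVecs q n) H)
      (trans (∑-map just (allFin q) _) (∑-cong (allFin q) (λ c → ∑-map (just c ∷_) (allVecs q n) H))))

  Z-∷ : ∀ {n} (L : Subset q) (Ls : Vec (Subset q) n) (g : Weights (suc n)) →
        Z (L ∷ Ls) g ≡ g zero nothing * Z Ls (g ∘ suc) + ∑[ c ∈ L ] g zero (just c) * Z (Ls ∖ c) (g ∘ suc)
  Z-∷ {n} L Ls g = begin
    Z (L ∷ Ls) g
      ≡⟨ ∑-filter (proper (L ∷ Ls)) (allVecs q (suc n)) (W g) ⟩
    ∑[ π ← allVecs q (suc n) ] [ proper (L ∷ Ls) π ]· W g π
      ≡⟨ ∑-allVecs-suc (λ π → [ proper (L ∷ Ls) π ]· W g π) ⟩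
    ∑[ τ ← allVecs q n ] [ proper Ls τ ]· W g (nothing ∷ τ)
      + ∑[ c ← allFin q ] ∑[ τ ← allVecs q n ] [ proper (L ∷ Ls) (just c ∷ τ) ]· W g (just c ∷ τ)
      ≡⟨ cong₂ _+_ blank (∑-cong (allFin q) coloured) ⟩
    g zero nothing * Z Ls (g ∘ suc) + ∑[ c ∈ L ] g zero (just c) * Z (Ls ∖ c) (g ∘ suc)
      ∎
    where
    open ≡-Reasoning
    blank : ∑[ τ ← allVecs q n ] [ proper Ls τ ]· W g (nothing ∷ τ) ≡ g zero nothing * Z Ls (g ∘ suc)
    blank = trans (∑-cong (allVecs q n) (λ τ → cong ([ proper Ls τ ]·_) (W-∷ g nothing τ)))
                  (sym (Z-∑ Ls (g ∘ suc) (g zero nothing)))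
    coloured : ∀ c → ∑[ τ ← allVecs q n ] [ proper (L ∷ Ls) (just c ∷ τ) ]· W g (just c ∷ τ)
                     ≡ [ ⌊ c ∈? L ⌋ ]· (g zero (just c) * Z (Ls ∖ c) (g ∘ suc))
    coloured c = begin
      ∑[ τ ← allVecs q n ] [ proper (L ∷ Ls) (just c ∷ τ) ]· W g (just c ∷ τ)
        ≡⟨ ∑-cong (allVecs q n) (λ τ →
             trans (cong₂ [_]·_ (cong (⌊ c ∈? L ⌋ ∧_) (sym (proper-∖ c Ls τ))) (W-∷ g (just c) τ))
                   ([]·-∧ ⌊ c ∈? L ⌋ (proper (Ls ∖ c) τ) _)) ⟩
      ∑[ τ ← allVecs q n ] [ ⌊ c ∈? L ⌋ ]· [ proper (Ls ∖ c) τ ]· (g zero (just c) * W (g ∘ suc) τ)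
        ≡⟨ []·-∑ ⌊ c ∈? L ⌋ (allVecs q n) _ ⟨
      [ ⌊ c ∈? L ⌋ ]· ∑[ τ ← allVecs q n ] [ proper (Ls ∖ c) τ ]· (g zero (just c) * W (g ∘ suc) τ)
        ≡⟨ cong ([ ⌊ c ∈? L ⌋ ]·_) (Z-∑ (Ls ∖ c) (g ∘ suc) (g zero (just c))) ⟨
      [ ⌊ c ∈? L ⌋ ]· (g zero (just c) * Z (Ls ∖ c) (g ∘ suc))
        ∎

  Z≢0 : ∀ {n} (Ls : Vec (Subset q) n) (g : Weights n) →
        (∀ i m → 0# ≤ g i m) → (∀ i → g i nothing ≢ 0#) → Z Ls g ≢ 0#
  Z≢0 []       g 0≤g g∅≢0 1+0≡0 = 0≢1 (sym (trans (sym (+-identityʳ 1#)) 1+0≡0))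
  Z≢0 (L ∷ Ls) g 0≤g g∅≢0 = subst (_≢ 0#) (sym (Z-∷ L Ls g))
    (x≢0∧x≤y⇒y≢0 (*-nonneg (0≤g zero nothing) (Z-nonneg Ls (g ∘ suc) (0≤g ∘ suc)))
      (x≤x+y (∑ₛ-nonneg L (λ c → *-nonneg (0≤g zero (just c)) (Z-nonneg (Ls ∖ c) (g ∘ suc) (0≤g ∘ suc)))))
      (*-≢0 (g∅≢0 zero) (Z≢0 Ls (g ∘ suc) (0≤g ∘ suc) (g∅≢0 ∘ suc))))

  ∑ₛ-∑-free : ∀ {k} (L : Subset q) (σs : List (Vec (Maybe (Fin q)) k))
              (F : Fin q → Vec (Maybe (Fin q)) k → Carrier) →
              ∑[ c ∈ L ] ∑[ σ ← σs ] [ not (uses (just c) σ) ]· F c σ ≡ ∑[ σ ← σs ] ∑[ c ∈ free L σ ] F c σ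
  ∑ₛ-∑-free L σs F = trans (∑-cong (allFin q) inner) (∑-comm (allFin q) σs _)
    where
    inner : ∀ c → [ ⌊ c ∈? L ⌋ ]· ∑[ σ ← σs ] [ not (uses (just c) σ) ]· F c σ
                ≡ ∑[ σ ← σs ] [ ⌊ c ∈? free L σ ⌋ ]· F c σ
    inner c = trans ([]·-∑ ⌊ c ∈? L ⌋ σs _) (∑-cong σs (λ σ →
      trans (sym ([]·-∧ ⌊ c ∈? L ⌋ _ (F c σ))) (cong ([_]· F c σ) (sym (⌊∈?free⌋ c L σ)))))

  -- The properties of m ↦ p(m̄) used below; spread holds since a colouring of the k child edges
  -- leaves at least ∣ L ∣ ∸ k colours of L free.
  record IsEdgeWeight (k : ℕ) (w : Maybe (Fin q) → Carrier) : Set where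
    field
      nonneg       : ∀ m → 0# ≤ w m
      just≤nothing : ∀ c → w (just c) ≤ w nothing
      spread       : ∀ (L : Subset q) b → k +ℕ b ≤ℕ ∣ L ∣ → fromℕ b * w nothing ≤ ∑[ c ∈ L ] w (just c)

  massBar-∑ : ∀ {k} (Cs : List (Vec (Maybe (Fin q)) k)) (p : Vec (Maybe (Fin q)) k → Carrier) m →
              massBar Cs p m ≡ ∑[ σ ← Cs ] [ not (uses m σ) ]· p σ
  massBar-∑ Cs p m = ∑-filter (λ σ → not (uses m σ)) Cs p

  massBar-isEdgeWeight : ∀ {k} (Cs : List (Vec (Maybe (Fin q)) k)) (p : Vec (Maybe (Fin q)) k → Carrier) →
                         (∀ σ → σ ∈ₗ Cs → 0# ≤ p σ) → IsEdgeWeight k (massBar Cs p)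
  massBar-isEdgeWeight {k} Cs p 0≤p = record { nonneg = nonneg ; just≤nothing = just≤nothing ; spread = spread }
    where
    nonneg : ∀ m → 0# ≤ massBar Cs p m
    nonneg m = subst (0# ≤_) (sym (massBar-∑ Cs p m))
      (∑-nonneg Cs (λ σ σ∈Cs → []·-nonneg (not (uses m σ)) (0≤p σ σ∈Cs)))

    just≤nothing : ∀ c → massBar Cs p (just c) ≤ massBar Cs p nothing
    just≤nothing c = subst₂ _≤_ (sym (massBar-∑ Cs p (just c))) (sym (massBar-∑ Cs p nothing))
      (∑-mono-≤ Cs (λ σ σ∈Cs → []·-≤ (not (uses (just c) σ)) (0≤p σ σ∈Cs)))

    spread : ∀ L b → k +ℕ b ≤ℕ ∣ L ∣ → fromℕ b * massBar Cs p nothing ≤ ∑[ c ∈ L ] massBar Cs p (just c)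
    spread L b k+b≤∣L∣ = begin
      fromℕ b * massBar Cs p nothing                          ≡⟨ cong (fromℕ b *_) (massBar-∑ Cs p nothing) ⟩
      fromℕ b * ∑ Cs p                                        ≡⟨ *-distribˡ-∑ (fromℕ b) Cs p ⟩
      ∑[ σ ← Cs ] fromℕ b * p σ                               ≤⟨ ∑-mono-≤ Cs b≤∣free∣ ⟩
      ∑[ σ ← Cs ] fromℕ ∣ free L σ ∣ * p σ                    ≡⟨ ∑-cong Cs (λ σ → ∑ₛ-const (free L σ) (p σ)) ⟨
      ∑[ σ ← Cs ] ∑[ c ∈ free L σ ] p σ                       ≡⟨ ∑ₛ-∑-free L Cs (λ _ σ → p σ) ⟨
      ∑[ c ∈ L ] ∑[ σ ← Cs ] [ not (uses (just c) σ) ]· p σ  ≡⟨ ∑ₛ-cong L (λ c → massBar-∑ Cs p (just c)) ⟨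
      ∑[ c ∈ L ] massBar Cs p (just c)                        ∎
      where
      open ≤-Reasoning
      b≤∣free∣ : ∀ σ → σ ∈ₗ Cs → fromℕ b * p σ ≤ fromℕ ∣ free L σ ∣ * p σ
      b≤∣free∣ σ σ∈Cs = *-monoʳ-≤-nonneg (0≤p σ σ∈Cs) (fromℕ-mono-≤ (k+m≤∣L∣⇒m≤∣free∣ b L σ k+b≤∣L∣))

  -- Whatever the colouring τ of the other edges, at least k + b colours of L are free for the
  -- first edge, so spread applies to free L τ.
  b*blank≤coloured : ∀ {n k b} (w : Maybe (Fin q) → Carrier) → IsEdgeWeight k w →
                     (L : Subset q) → n +ℕ (k +ℕ b) ≤ℕ ∣ L ∣ →
                     (Ls : Vec (Subset q) n) (g : Weights n) → (∀ i m → 0# ≤ g i m) →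
                     fromℕ b * (w nothing * Z Ls g) ≤ ∑[ c ∈ L ] w (just c) * Z (Ls ∖ c) g
  b*blank≤coloured {n} {k} {b} w isW L n+k+b≤∣L∣ Ls g 0≤g = begin
    fromℕ b * (w nothing * Z Ls g)
      ≡⟨ *-assoc (fromℕ b) (w nothing) (Z Ls g) ⟨
    fromℕ b * w nothing * Z Ls g
      ≡⟨ *-distribˡ-∑ (fromℕ b * w nothing) (Colorings Ls) (W g) ⟩
    ∑[ τ ← Colorings Ls ] fromℕ b * w nothing * W g τ
      ≤⟨ ∑-mono-≤ (Colorings Ls) (λ τ _ → *-monoʳ-≤-nonneg (W-nonneg g 0≤g τ) (spread-free τ)) ⟩
    ∑[ τ ← Colorings Ls ] (∑[ c ∈ free L τ ] w (just c)) * W g τ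
      ≡⟨ ∑-cong (Colorings Ls) (λ τ → *-distribʳ-∑ₛ (W g τ) (free L τ) (w ∘ just)) ⟩
    ∑[ τ ← Colorings Ls ] ∑[ c ∈ free L τ ] w (just c) * W g τ
      ≡⟨ ∑ₛ-∑-free L (Colorings Ls) (λ c τ → w (just c) * W g τ) ⟨
    ∑[ c ∈ L ] ∑[ τ ← Colorings Ls ] [ not (uses (just c) τ) ]· (w (just c) * W g τ)
      ≡⟨ ∑ₛ-cong L colour-c ⟩
    ∑[ c ∈ L ] w (just c) * Z (Ls ∖ c) g
      ∎
    where
    open ≤-Reasoning
    spread-free : ∀ τ → fromℕ b * w nothing ≤ ∑[ c ∈ free L τ ] w (just c)
    spread-free τ = IsEdgeWeight.spread isW (free L τ) b (k+m≤∣L∣⇒m≤∣free∣ (k +ℕ b) L τ n+k+b≤∣L∣)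
    colour-c : ∀ c → ∑[ τ ← Colorings Ls ] [ not (uses (just c) τ) ]· (w (just c) * W g τ)
                     ≡ w (just c) * Z (Ls ∖ c) g
    colour-c c = begin-equality
      ∑[ τ ← Colorings Ls ] [ not (uses (just c) τ) ]· (w (just c) * W g τ)
        ≡⟨ ∑-cong (Colorings Ls) (λ τ → *-[]· (w (just c)) (not (uses (just c) τ)) (W g τ)) ⟨
      ∑[ τ ← Colorings Ls ] w (just c) * ([ not (uses (just c) τ) ]· W g τ)
        ≡⟨ *-distribˡ-∑ (w (just c)) (Colorings Ls) _ ⟨
      w (just c) * (∑[ τ ← Colorings Ls ] [ not (uses (just c) τ) ]· W g τ)
        ≡⟨ cong (w (just c) *_) (Z-∖ c Ls g) ⟨
      w (just c) * Z (Ls ∖ c) g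
        ∎

  -- Condition on the colour of the first edge.  Colour a is paid for by the colourings giving
  -- that edge a free colour of L - a instead (b*blank≤coloured); every other colour c leaves the
  -- smaller instance Ls ∖ c, to which the induction hypothesis applies.
  Z-∖-bound : ∀ {n} (a : Fin q) β (Ls : Vec (Subset q) n) (g : Weights n) (K : Fin n → ℕ) →
              (∀ i → IsEdgeWeight (K i) (g i)) → (∀ i → n +ℕ (K i +ℕ β) ≤ℕ ∣ lookup Ls i ∣) →
              fromℕ β * Z Ls g ≤ fromℕ (β +ℕ n) * Z (Ls ∖ a) g
  Z-∖-bound a β [] g K isW deg = ≤-reflexive (cong (λ k → fromℕ k * Z [] g) (sym (ℕ.+-identityʳ β)))
  Z-∖-bound {suc n} a β (L ∷ Ls) g K isW deg = begin
    b * Z (L ∷ Ls) g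
      ≡⟨ cong (b *_) (trans (Z-∷ L Ls g) (cong (g∅ * Z Ls g′ +_) (∑ₛ-remove a L S))) ⟩
    b * (g∅ * Z Ls g′ + ([ ⌊ a ∈? L ⌋ ]· S a + ∑[ c ∈ L - a ] S c))
      ≡⟨ trans (distribˡ b _ _) (cong (b * (g∅ * Z Ls g′) +_) (distribˡ b _ _)) ⟩
    b * (g∅ * Z Ls g′) + (b * ([ ⌊ a ∈? L ⌋ ]· S a) + b * (∑[ c ∈ L - a ] S c))
      ≤⟨ +-mono-≤ blank (+-mono-≤ colour-a other-colours) ⟩
    m * A + (b * A + m * R′)
      ≤⟨ +-monoʳ-≤ (m * A) (+-monoˡ-≤ (m * R′) recolour-a) ⟩
    m * A + (R′ + m * R′)
      ≤⟨ m*x+[y+m*y]≤[1+m]*[x+y] (*-nonneg (0≤g zero nothing) (Z-nonneg (Ls ∖ a) g′ 0≤g′)) ⟩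
    (1# + m) * (A + R′)
      ≡⟨ cong₂ _*_ (cong fromℕ (sym (ℕ.+-suc β n))) (sym (Z-∷ (L - a) (Ls ∖ a) g)) ⟩
    fromℕ (β +ℕ suc n) * Z ((L ∷ Ls) ∖ a) g
      ∎
    where
    open ≤-Reasoning
    g′ : Weights n
    g′ = g ∘ suc
    b m g∅ A R′ : Carrier
    b = fromℕ β
    m = fromℕ (β +ℕ n)
    g∅ = g zero nothing
    A = g∅ * Z (Ls ∖ a) g′
    R′ = ∑[ c ∈ L - a ] g zero (just c) * Z (Ls ∖ a ∖ c) g′
    S : Fin q → Carrier
    S c = g zero (just c) * Z (Ls ∖ c) g′
    0≤g : ∀ i m → 0# ≤ g i m
    0≤g i = IsEdgeWeight.nonneg (isW i)
    0≤g′ : ∀ i m → 0# ≤ g′ i m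
    0≤g′ = 0≤g ∘ suc
    induction : ∀ Ls′ → (∀ i → n +ℕ (K (suc i) +ℕ β) ≤ℕ ∣ lookup Ls′ i ∣) → b * Z Ls′ g′ ≤ m * Z (Ls′ ∖ a) g′
    induction Ls′ = Z-∖-bound a β Ls′ g′ (K ∘ suc) (isW ∘ suc)
    blank : b * (g∅ * Z Ls g′) ≤ m * A
    blank = b*y≤m*z⇒b*[x*y]≤m*[x*z] (0≤g zero nothing) (induction Ls (ℕ.<⇒≤ ∘ deg ∘ suc))
    colour-a : b * ([ ⌊ a ∈? L ⌋ ]· S a) ≤ b * A
    colour-a = *-monoˡ-≤-nonneg (fromℕ-nonneg β)
      (≤-trans ([]·-≤ ⌊ a ∈? L ⌋ (*-nonneg (0≤g zero (just a)) (Z-nonneg (Ls ∖ a) g′ 0≤g′)))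
               (*-monoʳ-≤-nonneg (Z-nonneg (Ls ∖ a) g′ 0≤g′) (IsEdgeWeight.just≤nothing (isW zero) a)))
    recolour-a : b * A ≤ R′
    recolour-a = b*blank≤coloured (g zero) (isW zero) (L - a) (m<∣p∣⇒m≤∣p-x∣ L a (deg zero)) (Ls ∖ a) g′ 0≤g′
    colour-c : ∀ c → b * S c ≤ m * (g zero (just c) * Z (Ls ∖ a ∖ c) g′)
    colour-c c = b*y≤m*z⇒b*[x*y]≤m*[x*z] (0≤g zero (just c))
      (subst (λ Ls′ → b * Z (Ls ∖ c) g′ ≤ m * Z Ls′ g′) (∖-comm Ls c a)
        (induction (Ls ∖ c) (λ i → subst (n +ℕ (K (suc i) +ℕ β) ≤ℕ_) (cong ∣_∣ (sym (lookup-map i (_- c) Ls)))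
                                         (m<∣p∣⇒m≤∣p-x∣ (lookup Ls i) c (deg (suc i))))))
    other-colours : b * (∑[ c ∈ L - a ] S c) ≤ m * R′
    other-colours = begin
      b * (∑[ c ∈ L - a ] S c)                                 ≡⟨ *-distribˡ-∑ₛ b (L - a) S ⟩
      ∑[ c ∈ L - a ] b * S c                                   ≤⟨ ∑ₛ-mono-≤ (L - a) colour-c ⟩
      ∑[ c ∈ L - a ] m * (g zero (just c) * Z (Ls ∖ a ∖ c) g′) ≡⟨ *-distribˡ-∑ₛ m (L - a) _ ⟨
      m * R′                                                   ∎

  massBar-nothing≢0 : ∀ {k} (Cs : List (Vec (Maybe (Fin q)) k)) (p : Vec (Maybe (Fin q)) k → Carrier) →
                      (∀ σ → σ ∈ₗ Cs → 0# ≤ p σ) → ∀ {σ} → σ ∈ₗ Cs → p σ ≢ 0# → massBar Cs p nothing ≢ 0#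
  massBar-nothing≢0 Cs p 0≤p σ∈Cs pσ≢0 =
    x≢0∧x≤y⇒y≢0 (0≤p _ σ∈Cs) (subst (p _ ≤_) (sym (massBar-∑ Cs p nothing)) (term≤∑ Cs 0≤p σ∈Cs)) pσ≢0

  -- With g i = massBar (C (lookup ts i)) (p i), the functions W g, Z Ls g and gibbs Ls g are
  -- definitionally Root.weight, Root.Z and Root.f.
  gibbs : ∀ {n} → Vec (Subset q) n → Weights n → Vec (Maybe (Fin q)) n → Carrier
  gibbs Ls g π = W g π * Z Ls g ⁻¹

  gibbs-marginals : ∀ {n} (a : Fin q) β (Ls : Vec (Subset q) n) (g : Weights n) →
                    0# ≤ Z Ls g → Z Ls g ≢ 0# → fromℕ β * Z Ls g ≤ fromℕ (β +ℕ n) * Z (Ls ∖ a) g →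
                    let x = mass (Colorings Ls) (gibbs Ls g) a
                        y = massBar (Colorings Ls) (gibbs Ls g) (just a)
                    in (x + y ≡ 1#) × (fromℕ β * x ≤ fromℕ n * y)
  gibbs-marginals {n} a β Ls g 0≤Z Z≢0 balance = sum≡1 , ratio
    where
    x y : Carrier
    x = mass (Colorings Ls) (gibbs Ls g) a
    y = massBar (Colorings Ls) (gibbs Ls g) (just a)
    using-a avoiding-a : List (Vec (Maybe (Fin q)) n)
    using-a = filterᵇ (uses (just a)) (Colorings Ls)
    avoiding-a = filterᵇ (λ π → not (uses (just a) π)) (Colorings Ls)
    z U : Carrier
    z = Z Ls g ⁻¹
    U = ∑ using-a (W g)
    N≡Z∖a : ∑ avoiding-a (W g) ≡ Z (Ls ∖ a) g
    N≡Z∖a = trans (∑-filter _ (Colorings Ls) (W g)) (sym (Z-∖ a Ls g))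
    U+N≡Z : U + Z (Ls ∖ a) g ≡ Z Ls g
    U+N≡Z = trans (cong (U +_) (sym N≡Z∖a)) (∑-filter-split (uses (just a)) (Colorings Ls) (W g))
    mass≡ : x ≡ U * z
    mass≡ = sym (*-distribʳ-∑ z using-a (W g))
    massBar≡ : y ≡ Z (Ls ∖ a) g * z
    massBar≡ = trans (sym (*-distribʳ-∑ z avoiding-a (W g))) (cong (_* z) N≡Z∖a)
    sum≡1 : x + y ≡ 1#
    sum≡1 = trans (cong₂ _+_ mass≡ massBar≡)
                  (trans (sym (distribʳ z U _)) (trans (cong (_* z) U+N≡Z) (⁻¹-inverse (Z Ls g) Z≢0)))
    βU≤nN : fromℕ β * U ≤ fromℕ n * Z (Ls ∖ a) g
    βU≤nN = b*[u+n]≤[b+d]*n⇒b*u≤d*n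
      (subst₂ _≤_ (cong (fromℕ β *_) (sym U+N≡Z)) (cong (_* Z (Ls ∖ a) g) (fromℕ-+ β n)) balance)
    ratio : fromℕ β * x ≤ fromℕ n * y
    ratio = subst₂ _≤_ (trans (*-assoc _ _ _) (cong (fromℕ β *_) (sym mass≡)))
                       (trans (*-assoc _ _ _) (cong (fromℕ n *_) (sym massBar≡)))
                       (*-monoʳ-≤-nonneg (⁻¹-nonneg 0≤Z Z≢0) βU≤nN)

lemma3p4 : (R : CompleteOrderedField) → let open CompleteOrderedField R in let open Real R in
    (q β : ℕ) → 1 ≤ℕ β →
    (d : ℕ) (Ls : Vec (Subset q) d) (ts : Vec (RTree q) d) →
    BetaExtra β (node Ls ts) →
    (p : (i : Fin d) → Vec (Maybe (Fin q)) (arity (lookup ts i)) → Carrier) →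
    (∀ i τ → τ ∈ₗ C (lookup ts i) → 0# ≤ p i τ) →
    (∀ i → ∃ λ τ → τ ∈ₗ C (lookup ts i) × p i τ ≢ 0#) →
    (a : Fin q) →
    (Root.pr Ls ts p a ≤ fromℕ d * (fromℕ (β ∸ 1 +ℕ d) ⁻¹))
    × (fromℕ (β ∸ 1) * Root.pr Ls ts p a ≤ fromℕ d * Root.prBar Ls ts p a)
-- With no root edges no colouring uses a, so Root.pr reduces to 0#.
lemma3p4 R q (suc β) (s≤s z≤n) zero [] [] _ p _ _ a =
  ≤-reflexive (sym (zeroˡ _)) , ≤-reflexive (trans (zeroʳ _) (sym (zeroˡ _)))
  where
  open CompleteOrderedField R
  open OrderedFieldProperties R
lemma3p4 R q (suc β) (s≤s z≤n) (suc k) Ls ts extra p 0≤p p≢0 a = pr≤d/[β+d] , β*pr≤d*prBar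
  where
  open CompleteOrderedField R
  open Real R using (fromℕ; massBar; module Root)
  open OrderedFieldProperties R
  open PartitionFunction R

  pr prBar : Carrier
  pr = Root.pr Ls ts p a
  prBar = Root.prBar Ls ts p a

  G : Weights (suc k)
  G i = massBar (C (lookup ts i)) (p i)

  isW : ∀ i → IsEdgeWeight (arity (lookup ts i)) (G i)
  isW i = massBar-isEdgeWeight (C (lookup ts i)) (p i) (0≤p i)

  0≤G : ∀ i m → 0# ≤ G i m
  0≤G i = IsEdgeWeight.nonneg (isW i)

  G∅≢0 : ∀ i → G i nothing ≢ 0#
  G∅≢0 i = massBar-nothing≢0 (C (lookup ts i)) (p i) (0≤p i) (proj₁ (proj₂ (p≢0 i))) (proj₂ (proj₂ (p≢0 i)))

  marginals : (pr + prBar ≡ 1#) × (fromℕ β * pr ≤ fromℕ (suc k) * prBar)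
  marginals = gibbs-marginals a β Ls G (Z-nonneg Ls G 0≤G) (Z≢0 Ls G 0≤G G∅≢0)
                (Z-∖-bound a β Ls G _ isW (root-edge-bound β Ls ts extra))

  β*pr≤d*prBar : fromℕ β * pr ≤ fromℕ (suc k) * prBar
  β*pr≤d*prBar = proj₂ marginals

  β+d≢0 : fromℕ β + fromℕ (suc k) ≢ 0#
  β+d≢0 = subst (_≢ 0#) (trans (cong fromℕ (sym (ℕ.+-suc β k))) (fromℕ-+ β (suc k))) (fromℕ-suc≢0 (β +ℕ k))

  pr≤d/[β+d] : pr ≤ fromℕ (suc k) * fromℕ (β +ℕ suc k) ⁻¹
  pr≤d/[β+d] = subst (λ x → pr ≤ fromℕ (suc k) * x ⁻¹) (sym (fromℕ-+ β (suc k)))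
    (b*x≤d*y⇒x≤d/[b+d] (fromℕ-nonneg β) (fromℕ-nonneg (suc k)) β+d≢0 (proj₁ marginals) β*pr≤d*prBar)
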